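{- Let $k\ge2$, let $\mathcal{T}$ be a $k$-tree with maximum degree at least $2$, and let $\{\alpha_e\}_{e\in E(\mathcal{T})}$ be nonzero complex numbers. Let $u\in\mathcal{N}(\mathcal{T})$, let $P_{\mathcal{T}}(u)$ be a set of $d_{\mathcal{T}}(u)-1$ pendent edges incident to $u$, and let $f$ be the remaining edge incident to $u$. Assume $(\mathcal{T},u,P_{\mathcal{T}}(u))$ is admissible, i.e. $\sum_{g\in P_{\mathcal{T}}(u)}\alpha_g\ne1$. Let $\widehat{\mathcal{T}}$ be obtained from $\mathcal{T}$ by deleting all edges of $P_{\mathcal{T}}(u)$ and the resulting isolated vertices, and set $\widehat\alpha_e=\alpha_e$ for $e\in E(\widehat{\mathcal{T}})\setminus\{f\}$ and $\widehat\alpha_f=\alpha_f/\big(1-\sum_{g\in P_{\mathcal{T}}(u)}\alpha_g\big)$. Then: (1) if $\{\alpha_e\}_{e\in E(\mathcal{T})}$ is a root of $\widetilde\mu(\mathcal{T},\{x_e\}_{e\in E(\mathcal{T})})$, then $\{\widehat\alpha_e\}_{e\in E(\widehat{\mathcal{T}})}$ is a root of $\widetilde\mu(\widehat{\mathcal{T}},\{x_e\}_{e\in E(\widehat{\mathcal{T}})})$; (2) if $\widehat{\mathcal{T}}$ is generalized $\{\widehat\alpha_e\}_{e\in E(\widehat{\mathcal{T}})}$-normal, then $\mathcal{T}$ is generalized $\{\alpha_e\}_{e\in E(\mathcal{T})}$-normal.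
   Context: A $k$-graph has a finite vertex set and an edge set of $k$-element vertex subsets; $d(v)$ is the number of edges containing $v$. A $k$-tree is a connected $k$-graph without cycles (paths/cycles are alternating sequences of distinct vertices and edges with consecutive vertices lying in the edge between them; a cycle may repeat only its first vertex as its last); a $k$-forest is a $k$-graph without cycles. A pendent edge is an edge containing exactly $k-1$ vertices of degree one. $\mathcal{N}(\mathcal{T})$ is the set of vertices $u$ with $d_{\mathcal{T}}(u)\ge2$ that are incident with at most one non-pendent edge. For a $k$-forest $\mathcal{T}$ with set of matchings (sets of pairwise disjoint edges, including $\emptyset$) $\mathcal{M}(\mathcal{T})$, $\widetilde\mu(\mathcal{T},\{x_e\}_{e\in E(\mathcal{T})})=\sum_{M\in\mathcal{M}(\mathcal{T})}(-1)^{|M|}\prod_{e\in M}x_e$. A weighted incidence matrix of a $k$-graph $\mathcal{H}$ is a complex matrix $B$ indexed by $V(\mathcal{H})\times E(\mathcal{H})$ with $B(v,e)\ne0$ iff $v\in e$. For nonzero complex numbers $\{\alpha_e\}$, $\mathcal{H}$ is generalized $\{\alpha_e\}_{e\in E(\mathcal{H})}$-normal if there is a weighted incidence matrix $B$ with $\sum_{e\ni v}B(v,e)=1$ for every vertex $v$ and $\prod_{v\in e}B(v,e)=\alpha_e$ for every edge $e$. -}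

module Defs where

open import Level using (Level; _⊔_) renaming (suc to lsuc)
open import Data.Nat using (ℕ; zero; suc; _≤_; _∸_; _≡ᵇ_)
import Data.Nat as ℕ
open import Data.Bool using (Bool; true; false; _∧_; not; if_then_else_)
import Data.Bool as Bool
open import Data.Fin using (Fin; zero; suc; inject₁; fromℕ)
open import Data.Fin.Subset using (Subset; ∣_∣; _∩_; _⊆_) renaming (_∈_ to _∈ˢ_; _∉_ to _∉ˢ_; ⊥ to ∅)
open import Data.Fin.Subset.Properties using (_∈?_)
open import Data.Vec using (tabulate)
open import Data.Vec.Properties using (≡-dec)
open import Data.List using (List; []; _∷_; _++_; map; filter; length; foldr; allFin)
open import Data.List.Relation.Unary.All using (All)
open import Data.List.Relation.Unary.Any using (any?)
open import Data.List.Relation.Unary.AllPairs using (AllPairs)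
open import Data.List.Relation.Unary.AllPairs.Properties using ()
import Data.List.Relation.Unary.AllPairs as AP
open import Data.List.Relation.Unary.Unique.Propositional using (Unique)
open import Data.List.Membership.Propositional using () renaming (_∈_ to _∈ₗ_; _∉_ to _∉ₗ_)
open import Data.Product using (Σ; _×_; _,_)
open import Relation.Nullary using (¬_; Dec; ¬?; yes; no)
open import Relation.Nullary.Decidable using (_×-dec_; ⌊_⌋)
open import Relation.Binary.PropositionalEquality using (_≡_; refl)
open import Relation.Binary.Definitions using (DecidableEquality)
open import Algebra.Bundles using (CommutativeRing)
open import Function.Definitions using (Injective)

record Field c ℓ : Set (lsuc (c ⊔ ℓ)) where
  field
    commutativeRing : CommutativeRing c ℓ
  open CommutativeRing commutativeRing public
  field
    _⁻¹        : Carrier → Carrier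
    ⁻¹-inverse : ∀ x → ¬ (x ≈ 0#) → x * (x ⁻¹) ≈ 1#
    0≉1        : ¬ (0# ≈ 1#)

_≟ˢ_ : ∀ {n} → DecidableEquality (Subset n)
_≟ˢ_ = ≡-dec Bool._≟_

_∈ₗ?_ : ∀ {n} (e : Subset n) (E : List (Subset n)) → Dec (e ∈ₗ E)
e ∈ₗ? E = any? (e ≟ˢ_) E

IsKGraph : ∀ {n} (k : ℕ) (V : Subset n) (E : List (Subset n)) → Set
IsKGraph k V E = Unique E × All (λ e → ∣ e ∣ ≡ k × e ⊆ V) E

deg : ∀ {n} (E : List (Subset n)) (v : Fin n) → ℕ
deg E v = length (filter (v ∈?_) E)

record Path {n} (V : Subset n) (E : List (Subset n)) (a b : Fin n) : Set where
  field
    len    : ℕ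
    vs     : Fin (suc len) → Fin n
    es     : Fin len → Subset n
    vs-in  : ∀ i → vs i ∈ˢ V
    es-in  : ∀ i → es i ∈ₗ E
    vs-inj : Injective _≡_ _≡_ vs
    es-inj : Injective _≡_ _≡_ es
    start  : vs zero ≡ a
    end    : vs (fromℕ len) ≡ b
    left   : ∀ i → vs (inject₁ i) ∈ˢ es i
    right  : ∀ i → vs (suc i) ∈ˢ es i

-- cycles v_0 e_1 v_1 ... e_len v_len = v_0 (len ≥ 2, only first vertex repeated as last)
record Cycle {n} (V : Subset n) (E : List (Subset n)) : Set where
  field
    len    : ℕ
    len≥2  : 2 ≤ len
    vs     : Fin (suc len) → Fin n
    es     : Fin len → Subset n
    vs-in  : ∀ i → vs i ∈ˢ V
    es-in  : ∀ i → es i ∈ₗ E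
    vs-inj : Injective _≡_ _≡_ (λ i → vs (inject₁ i))
    es-inj : Injective _≡_ _≡_ es
    closed : vs (fromℕ len) ≡ vs zero
    left   : ∀ i → vs (inject₁ i) ∈ˢ es i
    right  : ∀ i → vs (suc i) ∈ˢ es i

Connected : ∀ {n} (V : Subset n) (E : List (Subset n)) → Set
Connected V E = ∀ a b → a ∈ˢ V → b ∈ˢ V → Path V E a b

IsKTree : ∀ {n} (k : ℕ) (V : Subset n) (E : List (Subset n)) → Set
IsKTree k V E = IsKGraph k V E × Connected V E × ¬ Cycle V E

MaxDegree≥2 : ∀ {n} (V : Subset n) (E : List (Subset n)) → Set
MaxDegree≥2 V E = Σ _ λ v → v ∈ˢ V × 2 ≤ deg E v

deg1Count : ∀ {n} (E : List (Subset n)) (e : Subset n) → ℕ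
deg1Count {n} E e = length (filter (λ v → (v ∈? e) ×-dec (deg E v ℕ.≟ 1)) (allFin n))

IsPendent : ∀ {n} (k : ℕ) (E : List (Subset n)) (e : Subset n) → Set
IsPendent k E e = e ∈ₗ E × deg1Count E e ≡ k ∸ 1

isPendent? : ∀ {n} k (E : List (Subset n)) e → Dec (IsPendent k E e)
isPendent? k E e = (e ∈ₗ? E) ×-dec (deg1Count E e ℕ.≟ (k ∸ 1))

InN : ∀ {n} (k : ℕ) (V : Subset n) (E : List (Subset n)) (u : Fin n) → Set
InN k V E u = u ∈ˢ V × 2 ≤ deg E u
  × length (filter (λ e → (u ∈? e) ×-dec ¬? (isPendent? k E e)) E) ≤ 1

IsPendentSetAt : ∀ {n} (k : ℕ) (E : List (Subset n)) (u : Fin n) (P : List (Subset n)) → Set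
IsPendentSetAt k E u P = Unique P × All (λ g → IsPendent k E g × u ∈ˢ g) P
  × length P ≡ deg E u ∸ 1

deleteEdges : ∀ {n} (E P : List (Subset n)) → List (Subset n)
deleteEdges E P = filter (λ e → ¬? (e ∈ₗ? P)) E

removeIsolated : ∀ {n} (V : Subset n) (E : List (Subset n)) → Subset n
removeIsolated V E = tabulate λ v → ⌊ v ∈? V ⌋ ∧ not (deg E v ≡ᵇ 0)

sublists : ∀ {a} {A : Set a} → List A → List (List A)
sublists [] = [] ∷ []
sublists (x ∷ xs) = sublists xs ++ map (x ∷_) (sublists xs)

Disjoint : ∀ {n} → Subset n → Subset n → Set
Disjoint p q = p ∩ q ≡ ∅

matchings : ∀ {n} (E : List (Subset n)) → List (List (Subset n))
matchings E = filter (AP.allPairs? (λ p q → (p ∩ q) ≟ˢ ∅)) (sublists E)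

module _ {c ℓ} (F : Field c ℓ) where
  open Field F

  sumF : List Carrier → Carrier
  sumF = foldr _+_ 0#

  prodF : List Carrier → Carrier
  prodF = foldr _*_ 1#

  sign : ℕ → Carrier
  sign zero = 1#
  sign (suc m) = - 1# * sign m

  muTilde : ∀ {n} (E : List (Subset n)) (x : Subset n → Carrier) → Carrier
  muTilde E x = sumF (map (λ M → sign (length M) * prodF (map x M)) (matchings E))

  IsRoot : ∀ {n} (E : List (Subset n)) (x : Subset n → Carrier) → Set ℓ
  IsRoot E x = muTilde E x ≈ 0#

  IsGenNormal : ∀ {n} (V : Subset n) (E : List (Subset n)) (α : Subset n → Carrier) → Set (c ⊔ ℓ)
  IsGenNormal {n} V E α = Σ (Fin n → Subset n → Carrier) λ B →
      (∀ v e → v ∈ˢ V → e ∈ₗ E → (v ∈ˢ e → ¬ (B v e ≈ 0#)) × (¬ (B v e ≈ 0#) → v ∈ˢ e))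
    × (∀ v → v ∈ˢ V → sumF (map (B v) (filter (v ∈?_) E)) ≈ 1#)
    × (∀ e → e ∈ₗ E → prodF (map (λ v → B v e) (filter (_∈? e) (allFin n))) ≈ α e)

  hatα : ∀ {n} (P : List (Subset n)) (f : Subset n) (α : Subset n → Carrier) → Subset n → Carrier
  hatα P f α e = if ⌊ e ≟ˢ f ⌋ then α f * ((1# - sumF (map α P)) ⁻¹) else α e

-- Every pendent edge g ∈ P meets the rest of the tree only in u, so in a matching it
-- either is absent or it excludes exactly the edges through u. Expanding μ̃ along the star
-- P at u, and then T̂ along its unique edge f at u, gives with s = Σ_{g∈P} α_g
--   μ̃(T, α) = μ̃(T̂, α) − s·A = (1 − s)·A − α_f·B,    μ̃(T̂, α̂) = A − α̂_f·B,
-- where A and B are μ̃ of the edges of T̂ missing u, resp. missing u and disjoint from f,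
-- which do not involve the weight of f. Hence (1 − s)·μ̃(T̂, α̂) = μ̃(T, α), giving (1).
-- For (2), a normal labelling B̂ of T̂ is extended by B(u, g) = α_g and B(v, g) = 1 at the
-- leaves v of g ∈ P, and B(u, f) = 1 − s. Then the row of u sums to 1, and since u is a
-- leaf of T̂ we have B̂(u, f) = 1, so the product over f becomes (1 − s)·α̂_f = α_f.
module Submission where

open import Level using (0ℓ; _⊔_) renaming (suc to lsuc)
open import Algebra.Bundles using (CommutativeMonoid)
open import Data.Bool using (true; false; if_then_else_; _∧_; not)
open import Data.Empty using (⊥-elim)
open import Data.Fin as Fin using (Fin; zero; suc)
open import Data.Fin.Subset using (Subset; ∣_∣; inside; outside; _∩_)
  renaming (_∈_ to _∈ˢ_; _∉_ to _∉ˢ_; ⊥ to ∅)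
open import Data.Fin.Subset.Properties using (_∈?_; ∩-comm; x∈p∩q⁺; x∈p∩q⁻; ∉⊥; Empty-unique)
open import Data.List using (List; []; _∷_; [_]; _++_; map; filter; foldr; length; tabulate; allFin)
open import Data.List.Properties
  using ( length-map; filter-notAll; filter-accept; filter-reject; filter-all; filter-none; filter-++; filter-≐
        ; map-++; map-∘; ++-identityʳ)
open import Data.List.Relation.Unary.All as All using (All; []; _∷_)
open import Data.List.Relation.Unary.All.Properties using (¬Any⇒All¬)
open import Data.List.Relation.Unary.AllPairs using ([]; _∷_)
import Data.List.Relation.Unary.AllPairs as AllPairs
open import Data.List.Relation.Unary.Any as Any using (Any; here; there; any?)
open import Data.List.Relation.Unary.Unique.Propositional using (Unique)
import Data.List.Relation.Unary.Unique.Propositional.Properties as Unique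
open import Data.List.Membership.Propositional using (_∈_; _∉_; find; lose)
open import Data.List.Membership.Propositional using () renaming (_∈_ to _∈ₗ_; _∉_ to _∉ₗ_)
open import Data.List.Membership.Propositional.Properties
  using (∈-filter⁺; ∈-filter⁻; ∈-allFin; ∈-++⁻; ∈-++⁺ˡ; ∈-++⁺ʳ; ∈-map⁻)
open import Data.List.Membership.Propositional.Properties.WithK using (unique∧set⇒bag)
open import Data.List.Relation.Binary.Subset.Propositional using (_⊆_)
open import Data.List.Relation.Binary.BagAndSetEquality using (_∼[_]_; set; ∼bag⇒↭)
open import Data.List.Relation.Binary.Permutation.Propositional as ↭ using (_↭_; ↭⇒↭ₛ′)
import Data.List.Relation.Binary.Permutation.Propositional.Properties as ↭
import Data.List.Relation.Binary.Permutation.Setoid.Properties as ↭ₛ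
open import Data.Nat using (ℕ; zero; suc; _≤_; _<_; _∸_; z≤n; s≤s; _≡ᵇ_)
import Data.Nat as ℕ
open import Data.Nat.Properties using (≤-trans; <-≤-trans; n≮n; m≤n+m∸n)
open import Data.Product using (_×_; _,_; proj₁; proj₂; ∃)
open import Data.Sum as Sum using (_⊎_; inj₁; inj₂; [_,_]′)
open import Data.Vec using ([]; _∷_)
open import Data.Vec.Properties using (lookup⇒[]=; lookup∘tabulate)
open import Function using (_∘_; id)
open import Function.Bundles using (mk⇔)
open import Relation.Binary.Definitions using (DecidableEquality)
open import Relation.Binary.PropositionalEquality as ≡ using (_≡_; cong; cong₂)
open import Relation.Nullary using (¬_; Dec; yes; no; ¬?; does)
open import Relation.Nullary.Decidable using (_×-dec_; dec-true; dec-false; isYes≗does; decidable-stable)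
open import Relation.Unary using (Pred; Decidable)
open import Relation.Unary.Properties using (U?)
open import Defs

module _ {a} {A : Set a} where

  unique∧set⇒↭ : ∀ {xs ys : List A} → Unique xs → Unique ys → xs ∼[ set ] ys → xs ↭ ys
  unique∧set⇒↭ xs! ys! xs∼ys = ∼bag⇒↭ (unique∧set⇒bag xs! ys! xs∼ys)

  ∈∧length≡1⇒≡[_] : ∀ {xs : List A} x → x ∈ xs → length xs ≡ 1 → xs ≡ [ x ]
  ∈∧length≡1⇒≡[_] {_ ∷ []} x (here ≡.refl) _ = ≡.refl

  ∈⇒0<length : ∀ {x} {xs : List A} → x ∈ xs → 0 < length xs
  ∈⇒0<length (here _) = s≤s z≤n
  ∈⇒0<length (there _) = s≤s z≤n

  0<length⇒∃∈ : ∀ {xs : List A} → 0 < length xs → ∃ (_∈ xs)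
  0<length⇒∃∈ {x ∷ _} _ = x , here ≡.refl

  ∈-sublists⇒⊆ : ∀ {xs ys : List A} → ys ∈ sublists xs → ys ⊆ xs
  ∈-sublists⇒⊆ {[]} (here ≡.refl) ()
  ∈-sublists⇒⊆ {x ∷ xs} ys∈ z∈ys with ∈-++⁻ (sublists xs) ys∈
  ... | inj₁ ys∈′ = there (∈-sublists⇒⊆ ys∈′ z∈ys)
  ... | inj₂ ys∈′ with ∈-map⁻ (x ∷_) ys∈′
  ...   | zs , zs∈ , ≡.refl with z∈ys
  ...     | here z≡x = here z≡x
  ...     | there z∈zs = there (∈-sublists⇒⊆ zs∈ z∈zs)

  filter-map : ∀ {b p} {B : Set b} {P : Pred B p} (P? : Decidable P) (f : A → B) xs →
               filter P? (map f xs) ≡ map f (filter (P? ∘ f) xs)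
  filter-map P? f [] = ≡.refl
  filter-map P? f (x ∷ xs) with does (P? (f x))
  ... | true = cong (f x ∷_) (filter-map P? f xs)
  ... | false = filter-map P? f xs

  module _ {p q} {P : Pred A p} {Q : Pred A q} (P? : Decidable P) (Q? : Decidable Q) where

    filter-filter : ∀ xs → filter P? (filter Q? xs) ≡ filter (λ x → Q? x ×-dec P? x) xs
    filter-filter [] = ≡.refl
    filter-filter (x ∷ xs) with does (Q? x)
    ... | false = filter-filter xs
    ... | true with does (P? x)
    ...   | false = filter-filter xs
    ...   | true = cong (x ∷_) (filter-filter xs)

    filter-≐-on : ∀ {xs} → (∀ {x} → x ∈ xs → P x → Q x) → (∀ {x} → x ∈ xs → Q x → P x) →
                  filter P? xs ≡ filter Q? xs
    filter-≐-on {[]} P⇒Q Q⇒P = ≡.refl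
    filter-≐-on {x ∷ xs} P⇒Q Q⇒P with P? x | Q? x
    ... | yes _   | yes _  = cong (x ∷_) (filter-≐-on (P⇒Q ∘ there) (Q⇒P ∘ there))
    ... | no _    | no _   = filter-≐-on (P⇒Q ∘ there) (Q⇒P ∘ there)
    ... | yes Px  | no ¬Qx = ⊥-elim (¬Qx (P⇒Q (here ≡.refl) Px))
    ... | no ¬Px  | yes Qx = ⊥-elim (¬Px (Q⇒P (here ≡.refl) Qx))

  filter-comm : ∀ {p q} {P : Pred A p} {Q : Pred A q} (P? : Decidable P) (Q? : Decidable Q) →
                ∀ xs → filter P? (filter Q? xs) ≡ filter Q? (filter P? xs)
  filter-comm P? Q? xs = ≡.trans (filter-filter P? Q? xs) (≡.trans
    (filter-≐-on (λ x → Q? x ×-dec P? x) (λ x → P? x ×-dec Q? x) {xs}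
      (λ _ (Qx , Px) → Px , Qx) (λ _ (Px , Qx) → Qx , Px))
    (≡.sym (filter-filter Q? P? xs)))

module _ {a} {A : Set a} (_≟_ : DecidableEquality A) where

  ∈⇒↭∷remove : ∀ {x} {xs : List A} → Unique xs → x ∈ xs → xs ↭ x ∷ filter (¬? ∘ (_≟ x)) xs
  ∈⇒↭∷remove {x} {xs} xs! x∈xs =
    unique∧set⇒↭ xs! (¬Any⇒All¬ _ x∉rest ∷ Unique.filter⁺ (¬? ∘ (_≟ x)) xs!) (mk⇔ to from)
    where
    x∉rest : x ∉ filter (¬? ∘ (_≟ x)) xs
    x∉rest x∈ = proj₂ (∈-filter⁻ (¬? ∘ (_≟ x)) {xs = xs} x∈) ≡.refl
    to : ∀ {y} → y ∈ xs → y ∈ x ∷ filter (¬? ∘ (_≟ x)) xs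
    to {y} y∈xs with y ≟ x
    ... | yes y≡x = here y≡x
    ... | no y≢x = there (∈-filter⁺ (¬? ∘ (_≟ x)) y∈xs y≢x)
    from : ∀ {y} → y ∈ x ∷ filter (¬? ∘ (_≟ x)) xs → y ∈ xs
    from (here ≡.refl) = x∈xs
    from (there y∈) = proj₁ (∈-filter⁻ (¬? ∘ (_≟ x)) {xs = xs} y∈)

  unique∧⊆⇒length≤ : ∀ {xs ys : List A} → Unique xs → xs ⊆ ys → length xs ≤ length ys
  unique∧⊆⇒length≤ {[]} _ _ = z≤n
  unique∧⊆⇒length≤ {x ∷ xs} {ys} (x∉xs ∷ xs!) x∷xs⊆ys =
    <-≤-trans (s≤s (unique∧⊆⇒length≤ xs! xs⊆ys-x)) (filter-notAll (¬? ∘ (x ≟_)) ys x∈ys)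
    where
    x∈ys = Any.map (λ x≡y x≢y → x≢y x≡y) (x∷xs⊆ys (here ≡.refl))
    xs⊆ys-x : xs ⊆ filter (¬? ∘ (x ≟_)) ys
    xs⊆ys-x z∈xs = ∈-filter⁺ (¬? ∘ (x ≟_)) (x∷xs⊆ys (there z∈xs)) (All.lookup x∉xs z∈xs)

  unique∧⊆∧length≤⇒⊇ : ∀ {xs ys : List A} → Unique xs → xs ⊆ ys → length ys ≤ length xs → ys ⊆ xs
  unique∧⊆∧length≤⇒⊇ {xs} xs! xs⊆ys |ys|≤|xs| {y} y∈ys with any? (y ≟_) xs
  ... | yes y∈xs = y∈xs
  ... | no y∉xs =
    ⊥-elim (n≮n _ (≤-trans (unique∧⊆⇒length≤ (¬Any⇒All¬ xs y∉xs ∷ xs!) y∷xs⊆ys) |ys|≤|xs|))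
    where
    y∷xs⊆ys : (y ∷ xs) ⊆ _
    y∷xs⊆ys (here ≡.refl) = y∈ys
    y∷xs⊆ys (there z∈xs) = xs⊆ys z∈xs

module _ {c ℓ} (M : CommutativeMonoid c ℓ) where
  open CommutativeMonoid M

  foldMap : ∀ {a} {A : Set a} → (A → Carrier) → List A → Carrier
  foldMap h xs = foldr _∙_ ε (map h xs)

  module _ {a} {A : Set a} where

    foldMap-cong-on : ∀ {g h : A → Carrier} xs → (∀ {x} → x ∈ xs → g x ≈ h x) → foldMap g xs ≈ foldMap h xs
    foldMap-cong-on [] g≈h = refl
    foldMap-cong-on (x ∷ xs) g≈h = ∙-cong (g≈h (here ≡.refl)) (foldMap-cong-on xs (g≈h ∘ there))

    foldMap-ε : ∀ {h : A → Carrier} xs → (∀ {x} → x ∈ xs → h x ≈ ε) → foldMap h xs ≈ ε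
    foldMap-ε [] h≈ε = refl
    foldMap-ε (x ∷ xs) h≈ε = trans (∙-cong (h≈ε (here ≡.refl)) (foldMap-ε xs (h≈ε ∘ there))) (identityˡ ε)

    foldMap-↭ : ∀ (h : A → Carrier) {xs ys} → xs ↭ ys → foldMap h xs ≈ foldMap h ys
    foldMap-↭ h xs↭ys =
      ↭ₛ.foldr-commMonoid setoid isCommutativeMonoid (↭⇒↭ₛ′ isEquivalence (↭.map⁺ h xs↭ys))

module _ {n : ℕ} where

  disjoint? : (p q : Subset n) → Dec (Disjoint p q)
  disjoint? p q = (p ∩ q) ≟ˢ ∅

  Disjoint-sym : ∀ {p q : Subset n} → Disjoint p q → Disjoint q p
  Disjoint-sym {p} {q} p∩q≡∅ = ≡.trans (∩-comm q p) p∩q≡∅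

  Disjoint⁺ : ∀ {p q : Subset n} → (∀ {v} → v ∈ˢ p → v ∉ˢ q) → Disjoint p q
  Disjoint⁺ {p} {q} p⊥q = Empty-unique λ (v , v∈p∩q) →
    let v∈p , v∈q = x∈p∩q⁻ p q v∈p∩q in p⊥q v∈p v∈q

  Disjoint⁻ : ∀ {p q : Subset n} {v} → Disjoint p q → v ∈ˢ p → v ∉ˢ q
  Disjoint⁻ p∩q≡∅ v∈p v∈q = ∉⊥ (≡.subst (_ ∈ˢ_) p∩q≡∅ (x∈p∩q⁺ (v∈p , v∈q)))

  disjointFrom : Subset n → List (Subset n) → List (Subset n)
  disjointFrom e = filter (disjoint? e)

  avoiding : Fin n → List (Subset n) → List (Subset n)
  avoiding u = filter (λ e → ¬? (u ∈? e))

  members : Subset n → List (Fin n)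
  members p = filter (_∈? p) (allFin n)

  members! : ∀ p → Unique (members p)
  members! p = Unique.filter⁺ (_∈? p) (Unique.allFin⁺ n)

  ∈-members⁻ : ∀ {p v} → v ∈ members p → v ∈ˢ p
  ∈-members⁻ {p} = proj₂ ∘ ∈-filter⁻ (_∈? p) {xs = allFin n}

  members↭∷ : ∀ {p v} → v ∈ˢ p → members p ↭ v ∷ filter (¬? ∘ (Fin._≟ v)) (members p)
  members↭∷ {p} {v} v∈p = ∈⇒↭∷remove Fin._≟_ (members! p) (∈-filter⁺ (_∈? p) (∈-allFin v) v∈p)

  ∈-removeIsolated⁺ : ∀ {V : Subset n} {L v e} → v ∈ˢ V → e ∈ L → v ∈ˢ e → v ∈ˢ removeIsolated V L
  ∈-removeIsolated⁺ {V} {L} {v} v∈V e∈L v∈e = lookup⇒[]= v _ (≡.trans (lookup∘tabulate _ v)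
    (cong₂ _∧_ (≡.trans (isYes≗does (v ∈? V)) (dec-true (v ∈? V) v∈V))
               (deg≢0 (∈⇒0<length (∈-filter⁺ (v ∈?_) e∈L v∈e)))))
    where
    deg≢0 : ∀ {m} → 0 < m → not (m ≡ᵇ 0) ≡ true
    deg≢0 (s≤s _) = ≡.refl

filter-∈-suc : ∀ {m n} b (p : Subset n) (h : Fin m → Fin n) →
  filter (_∈? (b ∷ p)) (tabulate (suc ∘ h)) ≡ map suc (filter (_∈? p) (tabulate h))
filter-∈-suc {zero} b p h = ≡.refl
filter-∈-suc {suc m} b p h with h zero ∈? p
... | yes _ = cong (suc (h zero) ∷_) (filter-∈-suc b p (h ∘ suc))
... | no _ = filter-∈-suc b p (h ∘ suc)

length-members : ∀ {n} (p : Subset n) → length (members p) ≡ ∣ p ∣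
length-members {zero} [] = ≡.refl
length-members {suc n} (inside ∷ p) = cong suc (≡.trans (cong length (filter-∈-suc inside p id))
  (≡.trans (length-map Fin.suc (members p)) (length-members p)))
length-members {suc n} (outside ∷ p) = ≡.trans (cong length (filter-∈-suc outside p id))
  (≡.trans (length-map Fin.suc (members p)) (length-members p))

-- Hypergraph facts

-- Pigeonhole: w and the k ∸ 1 degree-one vertices of g are k distinct vertices of g, hence all of them.
pendent-deg≡1 : ∀ {n k} {E : List (Subset n)} {g w v} → ∣ g ∣ ≡ k → deg1Count E g ≡ k ∸ 1 →
  w ∈ˢ g → ¬ deg E w ≡ 1 → v ∈ˢ g → ¬ v ≡ w → deg E v ≡ 1
pendent-deg≡1 {n} {k} {E} {g} {w} {v} ∣g∣≡k count≡k-1 w∈g deg-w≢1 v∈g v≢w =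
  deg≡1 (unique∧⊆∧length≤⇒⊇ Fin._≟_ w∷D! w∷D⊆g |g|≤|w∷D| (∈-filter⁺ (_∈? g) (∈-allFin v) v∈g))
  where
  D? = λ x → (x ∈? g) ×-dec (deg E x ℕ.≟ 1)
  D = filter D? (allFin n)
  w∉D : w ∉ D
  w∉D w∈D = deg-w≢1 (proj₂ (proj₂ (∈-filter⁻ D? {xs = allFin n} w∈D)))
  w∷D! : Unique (w ∷ D)
  w∷D! = ¬Any⇒All¬ D w∉D ∷ Unique.filter⁺ D? (Unique.allFin⁺ n)
  w∷D⊆g : (w ∷ D) ⊆ members g
  w∷D⊆g (here ≡.refl) = ∈-filter⁺ (_∈? g) (∈-allFin w) w∈g
  w∷D⊆g {x} (there x∈D) =
    ∈-filter⁺ (_∈? g) (∈-allFin x) (proj₁ (proj₂ (∈-filter⁻ D? {xs = allFin n} x∈D)))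
  |g|≤|w∷D| : length (members g) ≤ length (w ∷ D)
  |g|≤|w∷D| =
    ≡.subst₂ _≤_ (≡.sym (≡.trans (length-members g) ∣g∣≡k)) (cong suc (≡.sym count≡k-1)) (m≤n+m∸n k 1)
  deg≡1 : v ∈ w ∷ D → deg E v ≡ 1
  deg≡1 (here v≡w) = ⊥-elim (v≢w v≡w)
  deg≡1 (there v∈D) = proj₂ (proj₂ (∈-filter⁻ D? {xs = allFin n} v∈D))

NoIsolatedVertex : ∀ {n} → Subset n → List (Subset n) → Set
NoIsolatedVertex V E = ∀ {v} → v ∈ˢ V → ∃ λ e → e ∈ E × v ∈ˢ e

noIsolatedVertex : ∀ {n} {V : Subset n} {E} → MaxDegree≥2 V E → Connected V E → NoIsolatedVertex V E
noIsolatedVertex {E = E} (w , w∈V , 2≤deg-w) connected {v} v∈V = on-path (connected v w v∈V w∈V)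
  where
  on-path : Path _ E v w → ∃ λ e → e ∈ E × v ∈ˢ e
  on-path record { len = zero ; start = start ; end = end } with ≡.trans (≡.sym start) end
  ... | ≡.refl =
    let e , e∈ = 0<length⇒∃∈ (≤-trans (s≤s z≤n) 2≤deg-w) in e , ∈-filter⁻ (v ∈?_) {xs = E} e∈
  on-path record { len = suc _ ; es = es ; es-in = es-in ; start = start ; left = left } =
    es zero , es-in zero , ≡.subst (_∈ˢ es zero) start (left zero)

-- The part of the hypotheses that the argument uses.
record PendentStar {n} (E : List (Subset n)) (u : Fin n) (P : List (Subset n)) (f : Subset n) : Set where
  field
    E!       : Unique E
    P!       : Unique P
    P⊆E      : P ⊆ E
    u∈P      : ∀ {g} → g ∈ P → u ∈ˢ g
    f∈E      : f ∈ E
    u∈f      : u ∈ˢ f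
    f∉P      : f ∉ P
    star     : ∀ {e} → e ∈ E → u ∈ˢ e → e ∈ P ⊎ e ≡ f
    leaf-deg : ∀ {g v} → g ∈ P → v ∈ˢ g → ¬ v ≡ u → deg E v ≡ 1

  Ê : List (Subset n)
  Ê = deleteEdges E P

  ∈Ê⁺ : ∀ {e} → e ∈ E → e ∉ P → e ∈ Ê
  ∈Ê⁺ = ∈-filter⁺ (λ e → ¬? (e ∈ₗ? P))

  ∈Ê⁻ : ∀ {e} → e ∈ Ê → e ∈ E × e ∉ P
  ∈Ê⁻ = ∈-filter⁻ (λ e → ¬? (e ∈ₗ? P)) {xs = E}

  Ê! : Unique Ê
  Ê! = Unique.filter⁺ (λ e → ¬? (e ∈ₗ? P)) E!

  f∈Ê : f ∈ Ê
  f∈Ê = ∈Ê⁺ f∈E f∉P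

  u∉avoiding : ∀ {e} → e ∈ avoiding u Ê → u ∉ˢ e
  u∉avoiding = proj₂ ∘ ∈-filter⁻ (λ e → ¬? (u ∈? e)) {xs = Ê}

  edges-at-leaf : ∀ {g v} → g ∈ P → v ∈ˢ g → ¬ v ≡ u → filter (v ∈?_) E ≡ [ g ]
  edges-at-leaf g∈P v∈g v≢u =
    ∈∧length≡1⇒≡[ _ ] (∈-filter⁺ (_ ∈?_) (P⊆E g∈P) v∈g) (leaf-deg g∈P v∈g v≢u)

  pendent-private : ∀ {g e v} → g ∈ P → e ∈ E → v ∈ˢ g → v ∈ˢ e → ¬ v ≡ u → e ≡ g
  pendent-private g∈P e∈E v∈g v∈e v≢u
    with ≡.subst (_ ∈_) (edges-at-leaf g∈P v∈g v≢u) (∈-filter⁺ (_ ∈?_) e∈E v∈e)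
  ... | here e≡g = e≡g

  pendent⊥Ê : ∀ {g e} → g ∈ P → e ∈ Ê → u ∉ˢ e → Disjoint g e
  pendent⊥Ê g∈P e∈Ê u∉e = Disjoint⁺ λ v∈g v∈e →
    let e∈E , e∉P = ∈Ê⁻ e∈Ê
    in e∉P (≡.subst (_∈ P) (≡.sym (pendent-private g∈P e∈E v∈g v∈e λ { ≡.refl → u∉e v∈e })) g∈P)

  E↭P++Ê : E ↭ P ++ Ê
  E↭P++Ê = unique∧set⇒↭ E! (Unique.++⁺ P! Ê! λ (g∈P , g∈Ê) → proj₂ (∈Ê⁻ g∈Ê) g∈P)
    (mk⇔ to from)
    where
    to : ∀ {e} → e ∈ E → e ∈ P ++ Ê
    to {e} e∈E with e ∈ₗ? P
    ... | yes e∈P = ∈-++⁺ˡ e∈P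
    ... | no e∉P = ∈-++⁺ʳ P (∈Ê⁺ e∈E e∉P)
    from : ∀ {e} → e ∈ P ++ Ê → e ∈ E
    from e∈ = [ P⊆E , proj₁ ∘ ∈Ê⁻ ]′ (∈-++⁻ P e∈)

  Ê↭f∷avoiding : Ê ↭ f ∷ avoiding u Ê
  Ê↭f∷avoiding = unique∧set⇒↭ Ê! (¬Any⇒All¬ _ f∉ ∷ Unique.filter⁺ (λ e → ¬? (u ∈? e)) Ê!)
    (mk⇔ to from)
    where
    f∉ : f ∉ avoiding u Ê
    f∉ f∈ = u∉avoiding f∈ u∈f
    to : ∀ {e} → e ∈ Ê → e ∈ f ∷ avoiding u Ê
    to {e} e∈Ê with u ∈? e
    ... | no u∉e = there (∈-filter⁺ (λ e → ¬? (u ∈? e)) e∈Ê u∉e)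
    ... | yes u∈e = [ ⊥-elim ∘ proj₂ (∈Ê⁻ e∈Ê) , here ]′ (star (proj₁ (∈Ê⁻ e∈Ê)) u∈e)
    from : ∀ {e} → e ∈ f ∷ avoiding u Ê → e ∈ Ê
    from (here ≡.refl) = f∈Ê
    from (there e∈) = proj₁ (∈-filter⁻ (λ e → ¬? (u ∈? e)) {xs = Ê} e∈)

  edges-at-u : filter (u ∈?_) E ↭ f ∷ P
  edges-at-u = unique∧set⇒↭ (Unique.filter⁺ (u ∈?_) E!) (¬Any⇒All¬ P f∉P ∷ P!) (mk⇔ to from)
    where
    to : ∀ {e} → e ∈ filter (u ∈?_) E → e ∈ f ∷ P
    to e∈ = let e∈E , u∈e = ∈-filter⁻ (u ∈?_) {xs = E} e∈ in [ there , here ]′ (star e∈E u∈e)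
    from : ∀ {e} → e ∈ f ∷ P → e ∈ filter (u ∈?_) E
    from (here ≡.refl) = ∈-filter⁺ (u ∈?_) f∈E u∈f
    from (there g∈P) = ∈-filter⁺ (u ∈?_) (P⊆E g∈P) (u∈P g∈P)

  edges-at-u-in-Ê : filter (u ∈?_) Ê ↭ [ f ]
  edges-at-u-in-Ê = unique∧set⇒↭ (Unique.filter⁺ (u ∈?_) Ê!) ([] ∷ []) (mk⇔ to from)
    where
    to : ∀ {e} → e ∈ filter (u ∈?_) Ê → e ∈ [ f ]
    to e∈ = let e∈Ê , u∈e = ∈-filter⁻ (u ∈?_) {xs = Ê} e∈ in
      [ ⊥-elim ∘ proj₂ (∈Ê⁻ e∈Ê) , here ]′ (star (proj₁ (∈Ê⁻ e∈Ê)) u∈e)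
    from : ∀ {e} → e ∈ [ f ] → e ∈ filter (u ∈?_) Ê
    from (here ≡.refl) = ∈-filter⁺ (u ∈?_) f∈Ê u∈f

pendentStar : ∀ {n k} {V : Subset n} {E u P f} → IsKGraph k V E → InN k V E u → IsPendentSetAt k E u P →
  f ∈ E → u ∈ˢ f → f ∉ P → PendentStar E u P f
pendentStar {E = E} {u} {P} {f} (E! , E-edges) (_ , 2≤deg-u , _) (P! , P-pendent , |P|≡deg-1) f∈E u∈f f∉P = record
  { E! = E!
  ; P! = P!
  ; P⊆E = P⊆E
  ; u∈P = proj₂ ∘ All.lookup P-pendent
  ; f∈E = f∈E
  ; u∈f = u∈f
  ; f∉P = f∉P
  ; star = λ e∈E u∈e → Sum.swap (Any.toSum (edges-at-u⊆f∷P (∈-filter⁺ (u ∈?_) e∈E u∈e)))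
  ; leaf-deg = λ g∈P → pendent-deg≡1 {E = E} (proj₁ (All.lookup E-edges (P⊆E g∈P)))
                         (proj₂ (proj₁ (All.lookup P-pendent g∈P))) (proj₂ (All.lookup P-pendent g∈P)) deg-u≢1
  }
  where
  P⊆E : P ⊆ E
  P⊆E = proj₁ ∘ proj₁ ∘ All.lookup P-pendent
  deg-u≢1 : ¬ deg E u ≡ 1
  deg-u≢1 deg≡1 with ≡.subst (2 ≤_) deg≡1 2≤deg-u
  ... | s≤s ()
  f∷P⊆edges : (f ∷ P) ⊆ filter (u ∈?_) E
  f∷P⊆edges (here ≡.refl) = ∈-filter⁺ (u ∈?_) f∈E u∈f
  f∷P⊆edges (there g∈P) = ∈-filter⁺ (u ∈?_) (P⊆E g∈P) (proj₂ (All.lookup P-pendent g∈P))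
  edges-at-u⊆f∷P : filter (u ∈?_) E ⊆ f ∷ P
  edges-at-u⊆f∷P = unique∧⊆∧length≤⇒⊇ _≟ˢ_ (¬Any⇒All¬ P f∉P ∷ P!) f∷P⊆edges
    (≡.subst (λ m → deg E u ≤ suc m) (≡.sym |P|≡deg-1) (m≤n+m∸n (deg E u) 1))

-- Matchings

module _ {n : ℕ} where

  sublists-disjointFrom : ∀ (e : Subset n) L →
    filter (All.all? (disjoint? e)) (sublists L) ≡ sublists (disjointFrom e L)
  sublists-disjointFrom e [] = ≡.refl
  sublists-disjointFrom e (y ∷ L) = ≡.trans shared (by-cases (disjoint? e y))
    where
    D? = All.all? (disjoint? e)
    S = sublists L
    S′ = sublists (disjointFrom e L)
    shared : filter D? (sublists (y ∷ L)) ≡ S′ ++ map (y ∷_) (filter (D? ∘ (y ∷_)) S)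
    shared = ≡.trans (filter-++ D? S _) (cong₂ _++_ (sublists-disjointFrom e L) (filter-map D? (y ∷_) S))
    by-cases : Dec (Disjoint e y) →
      S′ ++ map (y ∷_) (filter (D? ∘ (y ∷_)) S) ≡ sublists (disjointFrom e (y ∷ L))
    by-cases (yes e⊥y) = ≡.trans
      (cong (λ M → S′ ++ map (y ∷_) M)
        (≡.trans (filter-≐ (D? ∘ (y ∷_)) D? ((λ where (_ ∷ e⊥M) → e⊥M) , (e⊥y ∷_)) S)
                 (sublists-disjointFrom e L)))
      (cong sublists (≡.sym (filter-accept (disjoint? e) e⊥y)))
    by-cases (no ¬e⊥y) = ≡.trans
      (cong (λ M → S′ ++ map (y ∷_) M)
        (filter-none (D? ∘ (y ∷_)) (All.universal (λ where _ (e⊥y ∷ _) → ¬e⊥y e⊥y) S)))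
      (≡.trans (++-identityʳ S′) (cong sublists (≡.sym (filter-reject (disjoint? e) ¬e⊥y))))

  matchings-∷ : ∀ (e : Subset n) L →
    matchings (e ∷ L) ≡ matchings L ++ map (e ∷_) (matchings (disjointFrom e L))
  matchings-∷ e L = begin
    filter AP? (S ++ map (e ∷_) S)
      ≡⟨ filter-++ AP? S _ ⟩
    matchings L ++ filter AP? (map (e ∷_) S)
      ≡⟨ cong (matchings L ++_) (filter-map AP? (e ∷_) S) ⟩
    matchings L ++ map (e ∷_) (filter (AP? ∘ (e ∷_)) S)
      ≡⟨ cong (λ M → matchings L ++ map (e ∷_) M) extensions ⟩
    matchings L ++ map (e ∷_) (matchings (disjointFrom e L)) ∎
    where
    open ≡.≡-Reasoning
    AP? = AllPairs.allPairs? disjoint?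
    D? = All.all? (disjoint? e)
    S = sublists L
    extensions : filter (AP? ∘ (e ∷_)) S ≡ matchings (disjointFrom e L)
    extensions = begin
      filter (AP? ∘ (e ∷_)) S
        ≡⟨ filter-≐ (AP? ∘ (e ∷_)) (λ M → D? M ×-dec AP? M)
             ((λ where (e⊥M ∷ M!) → e⊥M , M!) , (λ (e⊥M , M!) → e⊥M ∷ M!)) S ⟩
      filter (λ M → D? M ×-dec AP? M) S
        ≡⟨ filter-filter AP? D? S ⟨
      filter AP? (filter D? S)
        ≡⟨ cong (filter AP?) (sublists-disjointFrom e L) ⟩
      matchings (disjointFrom e L) ∎

module MatchingPolynomial {c ℓ} (F : Field c ℓ) where
  open Field F
  open import Relation.Binary.Reasoning.Setoid setoid
  open import Algebra.Properties.Ring ring using (-‿distribˡ-*; -1*x≈-x; -0#≈0#; -‿+-comm)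
  open import Algebra.Solver.Ring.NaturalCoefficients.Default commutativeSemiring using (solve; _:+_; _:*_; _:=_)

  sumF-++ : ∀ as bs → sumF F (as ++ bs) ≈ sumF F as + sumF F bs
  sumF-++ [] bs = sym (+-identityˡ _)
  sumF-++ (a ∷ as) bs = trans (+-congˡ (sumF-++ as bs)) (sym (+-assoc _ _ _))

  sumF-*ˡ : ∀ k as → sumF F (map (k *_) as) ≈ k * sumF F as
  sumF-*ˡ k [] = sym (zeroʳ k)
  sumF-*ˡ k (a ∷ as) = trans (+-congˡ (sumF-*ˡ k as)) (sym (distribˡ k _ _))

  muTilde-cong-on : ∀ {n} L {x y : Subset n → Carrier} → (∀ {e} → e ∈ L → x e ≈ y e) →
    muTilde F L x ≈ muTilde F L y
  muTilde-cong-on L x≈y = foldMap-cong-on +-commutativeMonoid (matchings L) λ {M} M∈ →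
    *-congˡ (foldMap-cong-on *-commutativeMonoid M λ e∈M →
      x≈y (∈-sublists⇒⊆ (proj₁ (∈-filter⁻ (AllPairs.allPairs? disjoint?) {xs = sublists L} M∈)) e∈M))

  module _ {n : ℕ} (x : Subset n → Carrier) where

    μ̃ : List (Subset n) → Carrier
    μ̃ L = muTilde F L x

    signedWeight : List (Subset n) → Carrier
    signedWeight M = sign F (length M) * prodF F (map x M)

    signedWeight-∷ : ∀ e M → signedWeight (e ∷ M) ≈ (- x e) * signedWeight M
    signedWeight-∷ e M = begin
      (- 1# * s) * (x e * p) ≈⟨ *-congʳ (-1*x≈-x s) ⟩
      (- s) * (x e * p)      ≈⟨ -‿distribˡ-* s (x e * p) ⟨
      - (s * (x e * p))      ≈⟨ -‿cong (solve 3 (λ s a p → s :* (a :* p) := a :* (s :* p)) refl s (x e) p) ⟩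
      - (x e * (s * p))      ≈⟨ -‿distribˡ-* (x e) (s * p) ⟩
      (- x e) * (s * p)      ∎
      where
      s = sign F (length M)
      p = prodF F (map x M)

    muTilde-∷ : ∀ e L → μ̃ (e ∷ L) ≈ μ̃ L + (- x e) * μ̃ (disjointFrom e L)
    muTilde-∷ e L = begin
      sumF F (map w (matchings (e ∷ L)))
        ≡⟨ cong (sumF F ∘ map w) (matchings-∷ e L) ⟩
      sumF F (map w (ML ++ map (e ∷_) MD))
        ≡⟨ cong (sumF F) (map-++ w ML _) ⟩
      sumF F (map w ML ++ map w (map (e ∷_) MD))
        ≈⟨ sumF-++ (map w ML) _ ⟩
      μ̃ L + sumF F (map w (map (e ∷_) MD))
        ≡⟨ cong (λ ts → μ̃ L + sumF F ts) (map-∘ MD) ⟨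
      μ̃ L + sumF F (map (w ∘ (e ∷_)) MD)
        ≈⟨ +-congˡ (foldMap-cong-on +-commutativeMonoid MD (λ {M} _ → signedWeight-∷ e M)) ⟩
      μ̃ L + sumF F (map (λ M → (- x e) * w M) MD)
        ≡⟨ cong (λ ts → μ̃ L + sumF F ts) (map-∘ MD) ⟩
      μ̃ L + sumF F (map ((- x e) *_) (map w MD))
        ≈⟨ +-congˡ (sumF-*ˡ (- x e) (map w MD)) ⟩
      μ̃ L + (- x e) * μ̃ (disjointFrom e L) ∎
      where
      w = signedWeight
      ML = matchings L
      MD = matchings (disjointFrom e L)

    muTilde-∷∷ : ∀ a b L → Disjoint a b →
      μ̃ (a ∷ b ∷ L) ≈ (μ̃ L + (- x b) * μ̃ (disjointFrom b L))
                       + (- x a) * (μ̃ (disjointFrom a L) + (- x b) * μ̃ (disjointFrom b (disjointFrom a L)))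
    muTilde-∷∷ a b L a⊥b = begin
      μ̃ (a ∷ b ∷ L)
        ≈⟨ muTilde-∷ a (b ∷ L) ⟩
      μ̃ (b ∷ L) + (- x a) * μ̃ (disjointFrom a (b ∷ L))
        ≡⟨ cong (λ M → μ̃ (b ∷ L) + (- x a) * μ̃ M) (filter-accept (disjoint? a) a⊥b) ⟩
      μ̃ (b ∷ L) + (- x a) * μ̃ (b ∷ disjointFrom a L)
        ≈⟨ +-cong (muTilde-∷ b L) (*-congˡ (muTilde-∷ b (disjointFrom a L))) ⟩
      (μ̃ L + (- x b) * μ̃ (disjointFrom b L))
        + (- x a) * (μ̃ (disjointFrom a L) + (- x b) * μ̃ (disjointFrom b (disjointFrom a L))) ∎

    muTilde-∷∷-¬Disjoint : ∀ a b L → ¬ Disjoint a b →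
      μ̃ (a ∷ b ∷ L) ≈ (μ̃ L + (- x b) * μ̃ (disjointFrom b L)) + (- x a) * μ̃ (disjointFrom a L)
    muTilde-∷∷-¬Disjoint a b L ¬a⊥b = begin
      μ̃ (a ∷ b ∷ L)
        ≈⟨ muTilde-∷ a (b ∷ L) ⟩
      μ̃ (b ∷ L) + (- x a) * μ̃ (disjointFrom a (b ∷ L))
        ≡⟨ cong (λ M → μ̃ (b ∷ L) + (- x a) * μ̃ M) (filter-reject (disjoint? a) ¬a⊥b) ⟩
      μ̃ (b ∷ L) + (- x a) * μ̃ (disjointFrom a L)
        ≈⟨ +-congʳ (muTilde-∷ b L) ⟩
      (μ̃ L + (- x b) * μ̃ (disjointFrom b L)) + (- x a) * μ̃ (disjointFrom a L) ∎

    muTilde-swap : ∀ a b L → μ̃ (a ∷ b ∷ L) ≈ μ̃ (b ∷ a ∷ L)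
    muTilde-swap a b L with disjoint? a b
    ... | yes a⊥b = begin
      μ̃ (a ∷ b ∷ L)
        ≈⟨ muTilde-∷∷ a b L a⊥b ⟩
      (m + nb * mb) + na * (ma + nb * mba)
        ≈⟨ solve 6 (λ m mb ma mba na nb →
            (m :+ nb :* mb) :+ na :* (ma :+ nb :* mba)
            := (m :+ na :* ma) :+ nb :* (mb :+ na :* mba)) refl m mb ma mba na nb ⟩
      (m + na * ma) + nb * (mb + na * mba)
        ≡⟨ cong (λ M → (m + na * ma) + nb * (mb + na * μ̃ M)) (filter-comm (disjoint? b) (disjoint? a) L) ⟩
      (m + na * ma) + nb * (mb + na * mab)
        ≈⟨ muTilde-∷∷ b a L (Disjoint-sym a⊥b) ⟨
      μ̃ (b ∷ a ∷ L) ∎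
      where
      m = μ̃ L
      ma = μ̃ (disjointFrom a L)
      mb = μ̃ (disjointFrom b L)
      mba = μ̃ (disjointFrom b (disjointFrom a L))
      mab = μ̃ (disjointFrom a (disjointFrom b L))
      na = - x a
      nb = - x b
    ... | no ¬a⊥b = begin
      μ̃ (a ∷ b ∷ L)
        ≈⟨ muTilde-∷∷-¬Disjoint a b L ¬a⊥b ⟩
      (m + nb * mb) + na * ma
        ≈⟨ solve 5 (λ m mb ma na nb → (m :+ nb :* mb) :+ na :* ma := (m :+ na :* ma) :+ nb :* mb)
            refl m mb ma na nb ⟩
      (m + na * ma) + nb * mb
        ≈⟨ muTilde-∷∷-¬Disjoint b a L (¬a⊥b ∘ Disjoint-sym) ⟨
      μ̃ (b ∷ a ∷ L) ∎
      where
      m = μ̃ L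
      ma = μ̃ (disjointFrom a L)
      mb = μ̃ (disjointFrom b L)
      na = - x a
      nb = - x b

    -- Quantifying over all filters makes the induction on _↭_ go through: muTilde-∷
    -- replaces L by its filter disjointFrom e L.
    _≋_ : List (Subset n) → List (Subset n) → Set (lsuc 0ℓ ⊔ ℓ)
    L ≋ L′ = ∀ {Q : Pred (Subset n) 0ℓ} (Q? : Decidable Q) → μ̃ (filter Q? L) ≈ μ̃ (filter Q? L′)

    ≋-∷ : ∀ e {L L′} → L ≋ L′ → (e ∷ L) ≋ (e ∷ L′)
    ≋-∷ e {L} {L′} L≋L′ Q? with does (Q? e)
    ... | false = L≋L′ Q?
    ... | true = begin
      μ̃ (e ∷ filter Q? L)
        ≈⟨ muTilde-∷ e (filter Q? L) ⟩
      μ̃ (filter Q? L) + (- x e) * μ̃ (disjointFrom e (filter Q? L))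
        ≡⟨ cong (λ M → μ̃ (filter Q? L) + (- x e) * μ̃ M) (filter-filter (disjoint? e) Q? L) ⟩
      μ̃ (filter Q? L) + (- x e) * μ̃ (filter Q∩e? L)
        ≈⟨ +-cong (L≋L′ Q?) (*-congˡ (L≋L′ Q∩e?)) ⟩
      μ̃ (filter Q? L′) + (- x e) * μ̃ (filter Q∩e? L′)
        ≡⟨ cong (λ M → μ̃ (filter Q? L′) + (- x e) * μ̃ M) (filter-filter (disjoint? e) Q? L′) ⟨
      μ̃ (filter Q? L′) + (- x e) * μ̃ (disjointFrom e (filter Q? L′))
        ≈⟨ muTilde-∷ e (filter Q? L′) ⟨
      μ̃ (e ∷ filter Q? L′) ∎
      where
      Q∩e? = λ q → Q? q ×-dec disjoint? e q

    ≋-swap : ∀ a b L → (a ∷ b ∷ L) ≋ (b ∷ a ∷ L)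
    ≋-swap a b L Q? with does (Q? a) in Qa | does (Q? b) in Qb
    ... | true  | true  rewrite Qa | Qb = muTilde-swap a b (filter Q? L)
    ... | true  | false rewrite Qa | Qb = refl
    ... | false | true  rewrite Qa | Qb = refl
    ... | false | false rewrite Qa | Qb = refl

    ↭⇒≋ : ∀ {L L′} → L ↭ L′ → L ≋ L′
    ↭⇒≋ ↭.refl Q? = refl
    ↭⇒≋ (↭.prep e L↭L′) = ≋-∷ e (↭⇒≋ L↭L′)
    ↭⇒≋ (↭.swap a b L↭L′) Q? = trans (≋-swap a b _ Q?) (≋-∷ b (≋-∷ a (↭⇒≋ L↭L′)) Q?)
    ↭⇒≋ (↭.trans L↭M M↭L′) Q? = trans (↭⇒≋ L↭M Q?) (↭⇒≋ M↭L′ Q?)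

    muTilde-↭ : ∀ {L L′} → L ↭ L′ → μ̃ L ≈ μ̃ L′
    muTilde-↭ {L} {L′} L↭L′ = begin
      μ̃ L              ≡⟨ cong μ̃ (filter-all U? (All.universal _ L)) ⟨
      μ̃ (filter U? L)  ≈⟨ ↭⇒≋ L↭L′ U? ⟩
      μ̃ (filter U? L′) ≡⟨ cong μ̃ (filter-all U? (All.universal _ L′)) ⟩
      μ̃ L′             ∎

    muTilde-star : ∀ u Q R → (∀ {q} → q ∈ Q → u ∈ˢ q) →
                   (∀ {q e} → q ∈ Q → e ∈ R → u ∉ˢ e → Disjoint q e) →
                   μ̃ (Q ++ R) ≈ μ̃ R + (- sumF F (map x Q)) * μ̃ (avoiding u R)
    muTilde-star u [] R _ _ = begin
      μ̃ R                              ≈⟨ +-identityʳ (μ̃ R) ⟨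
      μ̃ R + 0#                         ≈⟨ +-congˡ (zeroˡ _) ⟨
      μ̃ R + 0# * μ̃ (avoiding u R)      ≈⟨ +-congˡ (*-congʳ -0#≈0#) ⟨
      μ̃ R + (- 0#) * μ̃ (avoiding u R)  ∎
    muTilde-star u (g ∷ Q) R u∈Q Q⊥R = begin
      μ̃ (g ∷ Q ++ R)
        ≈⟨ muTilde-∷ g (Q ++ R) ⟩
      μ̃ (Q ++ R) + ng * μ̃ (disjointFrom g (Q ++ R))
        ≡⟨ cong (λ M → μ̃ (Q ++ R) + ng * μ̃ M) disjointFrom-g ⟩
      μ̃ (Q ++ R) + ng * A
        ≈⟨ +-congʳ (muTilde-star u Q R (u∈Q ∘ there) (Q⊥R ∘ there)) ⟩
      (μ̃ R + ns * A) + ng * A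
        ≈⟨ solve 4 (λ m A ns ng → (m :+ ns :* A) :+ ng :* A := m :+ (ng :+ ns) :* A)
            refl (μ̃ R) A ns ng ⟩
      μ̃ R + (ng + ns) * A
        ≈⟨ +-congˡ (*-congʳ (-‿+-comm (x g) s)) ⟩
      μ̃ R + (- (x g + s)) * A ∎
      where
      s = sumF F (map x Q)
      ng = - x g
      ns = - s
      A = μ̃ (avoiding u R)
      u∈g = u∈Q (here ≡.refl)
      disjointFrom-g : disjointFrom g (Q ++ R) ≡ avoiding u R
      disjointFrom-g = ≡.trans (filter-++ (disjoint? g) Q R) (cong₂ _++_
        (filter-none (disjoint? g) (All.tabulate λ q∈Q g⊥q → Disjoint⁻ g⊥q u∈g (u∈Q (there q∈Q))))
        (filter-≐-on (disjoint? g) (λ e → ¬? (u ∈? e))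
          (λ _ g⊥e → Disjoint⁻ g⊥e u∈g) (Q⊥R (here ≡.refl))))

-- Transferring roots and normal labellings along the star at u

module _ {c ℓ} (F : Field c ℓ) where
  open Field F
  open import Relation.Binary.Reasoning.Setoid setoid
  open import Algebra.Properties.Ring ring using (-‿distribˡ-*)
  open import Algebra.Solver.Ring.NaturalCoefficients.Default commutativeSemiring using (solve; _:+_; _:*_; _:=_; con)
  open MatchingPolynomial F

  1-x+x≈1 : ∀ x → (1# - x) + x ≈ 1#
  1-x+x≈1 x = begin
    (1# - x) + x   ≈⟨ +-assoc 1# (- x) x ⟩
    1# + (- x + x) ≈⟨ +-congˡ (-‿inverseˡ x) ⟩
    1# + 0#        ≈⟨ +-identityʳ 1# ⟩
    1#             ∎

  1-x≉0 : ∀ {x} → ¬ x ≈ 1# → ¬ 1# - x ≈ 0#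
  1-x≉0 {x} x≉1 1-x≈0 = x≉1 (begin
    x             ≈⟨ +-identityˡ x ⟨
    0# + x        ≈⟨ +-congʳ 1-x≈0 ⟨
    (1# - x) + x  ≈⟨ 1-x+x≈1 x ⟩
    1#            ∎)

  x*y≈0⇒y≈0 : ∀ {x y} → ¬ x ≈ 0# → x * y ≈ 0# → y ≈ 0#
  x*y≈0⇒y≈0 {x} {y} x≉0 xy≈0 = begin
    y                ≈⟨ *-identityˡ y ⟨
    1# * y           ≈⟨ *-congʳ (trans (*-comm _ _) (⁻¹-inverse x x≉0)) ⟨
    (x ⁻¹ * x) * y   ≈⟨ *-assoc _ x y ⟩
    x ⁻¹ * (x * y)   ≈⟨ *-congˡ xy≈0 ⟩
    x ⁻¹ * 0#        ≈⟨ zeroʳ _ ⟩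
    0#               ∎

  x*[y*x⁻¹]≈y : ∀ {x y} → ¬ x ≈ 0# → x * (y * x ⁻¹) ≈ y
  x*[y*x⁻¹]≈y {x} {y} x≉0 = begin
    x * (y * x ⁻¹)  ≈⟨ *-assoc x y _ ⟨
    (x * y) * x ⁻¹  ≈⟨ *-congʳ (*-comm x y) ⟩
    (y * x) * x ⁻¹  ≈⟨ *-assoc y x _ ⟩
    y * (x * x ⁻¹)  ≈⟨ *-congˡ (⁻¹-inverse x x≉0) ⟩
    y * 1#          ≈⟨ *-identityʳ y ⟩
    y               ∎

  hatα-≢ : ∀ {n} P f (α : Subset n → Carrier) {e} → ¬ e ≡ f → hatα F P f α e ≡ α e
  hatα-≢ P f α {e} e≢f with e ≟ˢ f
  ... | yes e≡f = ⊥-elim (e≢f e≡f)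
  ... | no _ = ≡.refl

  hatα-f : ∀ {n} P f (α : Subset n → Carrier) → hatα F P f α f ≡ α f * (1# - sumF F (map α P)) ⁻¹
  hatα-f P f α with f ≟ˢ f
  ... | yes _ = ≡.refl
  ... | no f≢f = ⊥-elim (f≢f ≡.refl)

  IsWeightedIncidence : ∀ {n} → Subset n → List (Subset n) → (Fin n → Subset n → Carrier) → Set ℓ
  IsWeightedIncidence V E B =
    ∀ v e → v ∈ˢ V → e ∈ E → (v ∈ˢ e → ¬ B v e ≈ 0#) × (¬ B v e ≈ 0# → v ∈ˢ e)

  VertexSums≈1 : ∀ {n} → Subset n → List (Subset n) → (Fin n → Subset n → Carrier) → Set ℓ
  VertexSums≈1 V E B = ∀ v → v ∈ˢ V → sumF F (map (B v) (filter (v ∈?_) E)) ≈ 1#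

  EdgeProducts≈ : ∀ {n} → List (Subset n) → (Fin n → Subset n → Carrier) → (Subset n → Carrier) → Set ℓ
  EdgeProducts≈ E B α = ∀ e → e ∈ E → prodF F (map (λ v → B v e) (members e)) ≈ α e

  module _ {n} {E u P f} (S : PendentStar {n} E u P f) where
    open PendentStar S

    isRoot-transfer : ∀ α → ¬ sumF F (map α P) ≈ 1# → IsRoot F E α → IsRoot F Ê (hatα F P f α)
    isRoot-transfer α s≉1 μ̃Eα≈0 = x*y≈0⇒y≈0 t≉0 (begin
      t * μ̃ α̂ Ê
        ≈⟨ *-congˡ (μ̃Ê α̂) ⟩
      t * (μ̃ α̂ Êᵘ + (- α̂ f) * μ̃ α̂ Êᶠ)
        ≈⟨ *-congˡ (+-cong A-indep (*-cong (-‿cong (reflexive (hatα-f P f α))) B-indep)) ⟩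
      t * (A + (- (α f * w)) * B)
        ≈⟨ *-congˡ (+-congˡ (*-congʳ (-‿distribˡ-* (α f) w))) ⟩
      t * (A + (nf * w) * B)
        ≈⟨ solve 5 (λ t A nf w B → t :* (A :+ (nf :* w) :* B) := t :* A :+ nf :* (t :* w) :* B)
            refl t A nf w B ⟩
      t * A + nf * (t * w) * B
        ≈⟨ +-congˡ (*-congʳ (*-congˡ (⁻¹-inverse t t≉0))) ⟩
      t * A + nf * 1# * B
        ≈⟨ solve 4 (λ ns A nf B → (con 1 :+ ns) :* A :+ nf :* con 1 :* B := (A :+ nf :* B) :+ ns :* A)
            refl (- s) A nf B ⟩
      (A + nf * B) + (- s) * A
        ≈⟨ +-congʳ (μ̃Ê α) ⟨
      μ̃ α Ê + (- s) * A
        ≈⟨ trans (muTilde-↭ α E↭P++Ê) (muTilde-star α u P Ê u∈P pendent⊥Ê) ⟨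
      μ̃ α E
        ≈⟨ μ̃Eα≈0 ⟩
      0# ∎)
      where
      s = sumF F (map α P)
      t = 1# - s
      w = t ⁻¹
      t≉0 = 1-x≉0 s≉1
      α̂ = hatα F P f α
      nf = - α f
      Êᵘ = avoiding u Ê
      Êᶠ = disjointFrom f Êᵘ
      A = μ̃ α Êᵘ
      B = μ̃ α Êᶠ
      μ̃Ê : ∀ x → μ̃ x Ê ≈ μ̃ x Êᵘ + (- x f) * μ̃ x Êᶠ
      μ̃Ê x = trans (muTilde-↭ x Ê↭f∷avoiding) (muTilde-∷ x f Êᵘ)
      ≢f : ∀ {e} → e ∈ Êᵘ → ¬ e ≡ f
      ≢f e∈ ≡.refl = u∉avoiding e∈ u∈f
      A-indep : μ̃ α̂ Êᵘ ≈ A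
      A-indep = muTilde-cong-on Êᵘ (reflexive ∘ hatα-≢ P f α ∘ ≢f)
      B-indep : μ̃ α̂ Êᶠ ≈ B
      B-indep =
        muTilde-cong-on Êᶠ (reflexive ∘ hatα-≢ P f α ∘ ≢f ∘ proj₁ ∘ ∈-filter⁻ (disjoint? f) {xs = Êᵘ})

    module Lift (V : Subset n) (α : Subset n → Carrier) (B̂ : Fin n → Subset n → Carrier) where
      s t : Carrier
      s = sumF F (map α P)
      t = 1# - s

      V̂ : Subset n
      V̂ = removeIsolated V Ê

      lift : Fin n → Subset n → Carrier
      lift v e = if does (v ∈? e) then onEdge else 0#
        where
        onEdge : Carrier
        onEdge = if does (v Fin.≟ u)
                 then (if does (e ∈ₗ? P) then α e else t)
                 else (if does (e ∈ₗ? P) then 1# else B̂ v e)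

      lift-∉ : ∀ {v e} → v ∉ˢ e → lift v e ≡ 0#
      lift-∉ {v} {e} v∉e rewrite dec-false (v ∈? e) v∉e = ≡.refl

      lift-u-pendent : ∀ {g} → g ∈ P → lift u g ≡ α g
      lift-u-pendent {g} g∈P
        rewrite dec-true (u ∈? g) (u∈P g∈P) | dec-true (u Fin.≟ u) ≡.refl | dec-true (g ∈ₗ? P) g∈P = ≡.refl

      lift-u-other : ∀ {e} → e ∉ P → u ∈ˢ e → lift u e ≡ t
      lift-u-other {e} e∉P u∈e
        rewrite dec-true (u ∈? e) u∈e | dec-true (u Fin.≟ u) ≡.refl | dec-false (e ∈ₗ? P) e∉P = ≡.refl

      lift-leaf : ∀ {g v} → g ∈ P → v ∈ˢ g → ¬ v ≡ u → lift v g ≡ 1#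
      lift-leaf {g} {v} g∈P v∈g v≢u
        rewrite dec-true (v ∈? g) v∈g | dec-false (v Fin.≟ u) v≢u | dec-true (g ∈ₗ? P) g∈P = ≡.refl

      lift-other : ∀ {e v} → e ∉ P → v ∈ˢ e → ¬ v ≡ u → lift v e ≡ B̂ v e
      lift-other {e} {v} e∉P v∈e v≢u
        rewrite dec-true (v ∈? e) v∈e | dec-false (v Fin.≟ u) v≢u | dec-false (e ∈ₗ? P) e∉P = ≡.refl

      lift-isWeightedIncidence : (∀ e → e ∈ E → ¬ α e ≈ 0#) → ¬ s ≈ 1# →
        IsWeightedIncidence V̂ Ê B̂ → IsWeightedIncidence V E lift
      lift-isWeightedIncidence α≉0 s≉1 B̂-inc v e v∈V e∈E = lift≉0 , ∈-of-lift≉0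
        where
        ≉0-via : ∀ {b} → lift v e ≡ b → ¬ b ≈ 0# → ¬ lift v e ≈ 0#
        ≉0-via lift≡b b≉0 lift≈0 = b≉0 (trans (sym (reflexive lift≡b)) lift≈0)
        ∈-of-lift≉0 : ¬ lift v e ≈ 0# → v ∈ˢ e
        ∈-of-lift≉0 lift≉0 = decidable-stable (v ∈? e) (lift≉0 ∘ reflexive ∘ lift-∉)
        lift≉0 : v ∈ˢ e → ¬ lift v e ≈ 0#
        lift≉0 v∈e = by-cases (e ∈ₗ? P) (v Fin.≟ u)
          where
          by-cases : Dec (e ∈ P) → Dec (v ≡ u) → ¬ lift v e ≈ 0#
          by-cases (yes e∈P) (yes ≡.refl) = ≉0-via (lift-u-pendent e∈P) (α≉0 e e∈E)
          by-cases (yes e∈P) (no v≢u)     = ≉0-via (lift-leaf e∈P v∈e v≢u) (0≉1 ∘ sym)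
          by-cases (no e∉P)  (yes ≡.refl) = ≉0-via (lift-u-other e∉P v∈e) (1-x≉0 s≉1)
          by-cases (no e∉P)  (no v≢u)     = ≉0-via (lift-other e∉P v∈e v≢u)
            (proj₁ (B̂-inc v e (∈-removeIsolated⁺ v∈V (∈Ê⁺ e∈E e∉P) v∈e) (∈Ê⁺ e∈E e∉P)) v∈e)

      lift-vertexSums : NoIsolatedVertex V E → VertexSums≈1 V̂ Ê B̂ → VertexSums≈1 V E lift
      lift-vertexSums covered B̂-sums v v∈V = by-cases (v Fin.≟ u) (any? (v ∈?_) P)
        where
        by-cases : Dec (v ≡ u) → Dec (Any (v ∈ˢ_) P) → sumF F (map (lift v) (filter (v ∈?_) E)) ≈ 1#
        by-cases (yes ≡.refl) _ = begin
          sumF F (map (lift u) (filter (u ∈?_) E))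
            ≈⟨ foldMap-↭ +-commutativeMonoid (lift u) edges-at-u ⟩
          lift u f + sumF F (map (lift u) P)
            ≈⟨ +-cong (reflexive (lift-u-other f∉P u∈f))
                (foldMap-cong-on +-commutativeMonoid P (reflexive ∘ lift-u-pendent)) ⟩
          t + s
            ≈⟨ 1-x+x≈1 s ⟩
          1# ∎
        by-cases (no v≢u) (yes v∈P) = let g , g∈P , v∈g = find v∈P in begin
          sumF F (map (lift v) (filter (v ∈?_) E))
            ≡⟨ cong (sumF F ∘ map (lift v)) (edges-at-leaf g∈P v∈g v≢u) ⟩
          lift v g + 0#
            ≈⟨ +-identityʳ _ ⟩
          lift v g
            ≡⟨ lift-leaf g∈P v∈g v≢u ⟩
          1# ∎
        by-cases (no v≢u) (no v∉P) = begin
          sumF F (map (lift v) (filter (v ∈?_) E))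
            ≈⟨ foldMap-cong-on +-commutativeMonoid _ (λ e∈ →
                 let _ , v∈e = ∈-filter⁻ (v ∈?_) {xs = E} e∈ in reflexive (lift-other (∉P v∈e) v∈e v≢u)) ⟩
          sumF F (map (B̂ v) (filter (v ∈?_) E))
            ≡⟨ cong (sumF F ∘ map (B̂ v)) edges-at-v ⟨
          sumF F (map (B̂ v) (filter (v ∈?_) Ê))
            ≈⟨ B̂-sums v v∈V̂ ⟩
          1# ∎
          where
          ∉P : ∀ {e} → v ∈ˢ e → e ∉ P
          ∉P v∈e e∈P = v∉P (lose e∈P v∈e)
          edges-at-v : filter (v ∈?_) Ê ≡ filter (v ∈?_) E
          edges-at-v = ≡.trans (filter-comm (v ∈?_) (λ e → ¬? (e ∈ₗ? P)) E)
            (filter-all (λ e → ¬? (e ∈ₗ? P)) (All.tabulate (∉P ∘ proj₂ ∘ ∈-filter⁻ (v ∈?_) {xs = E})))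
          v∈V̂ : v ∈ˢ V̂
          v∈V̂ = let e , e∈E , v∈e = covered v∈V in ∈-removeIsolated⁺ v∈V (∈Ê⁺ e∈E (∉P v∈e)) v∈e

      Π : Subset n → (Fin n → Subset n → Carrier) → List (Fin n) → Carrier
      Π e B vs = prodF F (map (λ v → B v e) vs)

      others : Subset n → List (Fin n)
      others e = filter (¬? ∘ (Fin._≟ u)) (members e)

      ∈-others⁻ : ∀ {e v} → v ∈ others e → v ∈ˢ e × ¬ v ≡ u
      ∈-others⁻ {e} v∈ = let v∈e , v≢u = ∈-filter⁻ (¬? ∘ (Fin._≟ u)) {xs = members e} v∈ in ∈-members⁻ v∈e , v≢u

      Π-at-u : ∀ {e} B → u ∈ˢ e → Π e B (members e) ≈ B u e * Π e B (others e)
      Π-at-u B u∈e = foldMap-↭ *-commutativeMonoid _ (members↭∷ u∈e)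

      B̂-u-f : u ∈ˢ V → VertexSums≈1 V̂ Ê B̂ → B̂ u f ≈ 1#
      B̂-u-f u∈V B̂-sums = begin
        B̂ u f                                   ≈⟨ +-identityʳ _ ⟨
        B̂ u f + 0#                              ≈⟨ foldMap-↭ +-commutativeMonoid (B̂ u) edges-at-u-in-Ê ⟨
        sumF F (map (B̂ u) (filter (u ∈?_) Ê))   ≈⟨ B̂-sums u (∈-removeIsolated⁺ u∈V f∈Ê u∈f) ⟩
        1#                                      ∎

      lift-product-pendent : ∀ {g} → g ∈ P → Π g lift (members g) ≈ α g
      lift-product-pendent g∈P = begin
        Π _ lift (members _)
          ≈⟨ Π-at-u lift (u∈P g∈P) ⟩
        lift u _ * Π _ lift (others _)
          ≈⟨ *-cong (reflexive (lift-u-pendent g∈P)) (foldMap-ε *-commutativeMonoid _ λ v∈ →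
              let v∈g , v≢u = ∈-others⁻ v∈ in reflexive (lift-leaf g∈P v∈g v≢u)) ⟩
        α _ * 1#
          ≈⟨ *-identityʳ _ ⟩
        α _ ∎

      lift-product-f : ¬ s ≈ 1# → u ∈ˢ V → VertexSums≈1 V̂ Ê B̂ → EdgeProducts≈ Ê B̂ (hatα F P f α) →
        Π f lift (members f) ≈ α f
      lift-product-f s≉1 u∈V B̂-sums B̂-prods = begin
        Π f lift (members f)
          ≈⟨ Π-at-u lift u∈f ⟩
        lift u f * Π f lift (others f)
          ≈⟨ *-cong (reflexive (lift-u-other f∉P u∈f)) (foldMap-cong-on *-commutativeMonoid _ λ v∈ →
              let v∈f , v≢u = ∈-others⁻ v∈ in reflexive (lift-other f∉P v∈f v≢u)) ⟩
        t * Π f B̂ (others f)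
          ≈⟨ *-congˡ (*-identityˡ _) ⟨
        t * (1# * Π f B̂ (others f))
          ≈⟨ *-congˡ (*-congʳ (B̂-u-f u∈V B̂-sums)) ⟨
        t * (B̂ u f * Π f B̂ (others f))
          ≈⟨ *-congˡ (Π-at-u B̂ u∈f) ⟨
        t * Π f B̂ (members f)
          ≈⟨ *-congˡ (B̂-prods f f∈Ê) ⟩
        t * hatα F P f α f
          ≡⟨ cong (t *_) (hatα-f P f α) ⟩
        t * (α f * t ⁻¹)
          ≈⟨ x*[y*x⁻¹]≈y (1-x≉0 s≉1) ⟩
        α f ∎

      lift-product-other : EdgeProducts≈ Ê B̂ (hatα F P f α) →
        ∀ {e} → e ∈ E → e ∉ P → ¬ e ≡ f → Π e lift (members e) ≈ α e
      lift-product-other B̂-prods {e} e∈E e∉P e≢f = begin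
        Π e lift (members e)
          ≈⟨ foldMap-cong-on *-commutativeMonoid _ (λ v∈ →
               reflexive (lift-other e∉P (∈-members⁻ v∈) λ { ≡.refl → u∉e (∈-members⁻ v∈) })) ⟩
        Π e B̂ (members e)
          ≈⟨ B̂-prods e (∈Ê⁺ e∈E e∉P) ⟩
        hatα F P f α e
          ≡⟨ hatα-≢ P f α e≢f ⟩
        α e ∎
        where
        u∉e : u ∉ˢ e
        u∉e u∈e = [ e∉P , e≢f ]′ (star e∈E u∈e)

      lift-edgeProducts : ¬ s ≈ 1# → u ∈ˢ V → VertexSums≈1 V̂ Ê B̂ → EdgeProducts≈ Ê B̂ (hatα F P f α) →
        EdgeProducts≈ E lift α
      lift-edgeProducts s≉1 u∈V B̂-sums B̂-prods e e∈E = by-cases (e ∈ₗ? P) (e ≟ˢ f)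
        where
        by-cases : Dec (e ∈ P) → Dec (e ≡ f) → Π e lift (members e) ≈ α e
        by-cases (yes e∈P) _            = lift-product-pendent e∈P
        by-cases (no e∉P)  (yes ≡.refl) = lift-product-f s≉1 u∈V B̂-sums B̂-prods
        by-cases (no e∉P)  (no e≢f)     = lift-product-other B̂-prods e∈E e∉P e≢f

    isGenNormal-lift : ∀ V α → u ∈ˢ V → (∀ e → e ∈ E → ¬ α e ≈ 0#) → NoIsolatedVertex V E →
      ¬ sumF F (map α P) ≈ 1# → IsGenNormal F (removeIsolated V Ê) Ê (hatα F P f α) → IsGenNormal F V E α
    isGenNormal-lift V α u∈V α≉0 covered s≉1 (B̂ , B̂-inc , B̂-sums , B̂-prods) =
        lift
      , lift-isWeightedIncidence α≉0 s≉1 B̂-inc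
      , lift-vertexSums covered B̂-sums
      , lift-edgeProducts s≉1 u∈V B̂-sums B̂-prods
      where open Lift V α B̂

lemma3p6 : ∀ {c ℓ} (F : Field c ℓ) (k n : ℕ) → 2 ≤ k
    → (V : Subset n) (E : List (Subset n)) → IsKTree k V E → MaxDegree≥2 V E
    → (α : Subset n → Field.Carrier F) → (∀ e → e ∈ₗ E → ¬ (Field._≈_ F (α e) (Field.0# F)))
    → (u : Fin n) → InN k V E u
    → (P : List (Subset n)) → IsPendentSetAt k E u P
    → (f : Subset n) → f ∈ₗ E → u ∈ˢ f → f ∉ₗ P
    → ¬ (Field._≈_ F (sumF F (map α P)) (Field.1# F))
    → (IsRoot F E α → IsRoot F (deleteEdges E P) (hatα F P f α))
      × (IsGenNormal F (removeIsolated V (deleteEdges E P)) (deleteEdges E P) (hatα F P f α)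
         → IsGenNormal F V E α)
lemma3p6 F k n _ V E (E-graph , connected , _) maxDeg α α≉0 u u∈N P P-pendent f f∈E u∈f f∉P s≉1 =
  isRoot-transfer F star α s≉1 ,
  isGenNormal-lift F star V α (proj₁ u∈N) α≉0 (noIsolatedVertex maxDeg connected) s≉1
  where
  star : PendentStar E u P f
  star = pendentStar E-graph u∈N P-pendent f∈E u∈f f∉P
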